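{- Let $(K_{k,k},\sigma)$ be a signed complete bipartite graph whose negative edges induce an $r$-regular subgraph $H$ of order $2k$ (all other edges positive). Let the eigenvalues of the (unsigned) graph $H$ be $\mu_1=r\ge\mu_2\ge\cdots\ge\mu_{2k}=-r$. Then $-2\mu_i$ is an eigenvalue of $(K_{k,k},\sigma)$ for $i=2,\dots,2k-1$, and the other two eigenvalues of $(K_{k,k},\sigma)$ are $k-2r$ and $-k+2r$; that is, the spectrum of $(K_{k,k},\sigma)$ is the multiset $\{k-2r,\,-k+2r\}\cup\{ -2\mu_i: 2\le i\le 2k-1\}$.
   Context: A signed graph $\Gamma=(G,\sigma)$ consists of a simple graph $G$ and a sign function $\sigma:E(G)\to\{ -1,1\}$; edges with sign $-1$ are negative. Its adjacency matrix $A(\Gamma)$ has $(i,j)$ entry $\sigma(v_iv_j)$ if $v_iv_j\in E(G)$ and $0$ otherwise; eigenvalues of $\Gamma$ are those of $A(\Gamma)$ with multiplicity. Eigenvalues of an unsigned graph are those of its ordinary adjacency matrix. "Negative edges induce $H$" means $H$ is the subgraph of $K_{k,k}$ formed by the negative edges and their endpoints. -}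

module Defs where

open import Data.Bool using (Bool; true; false; if_then_else_)
open import Data.Nat using (ℕ; zero; suc)
import Data.Nat as ℕ
open import Data.Fin using (Fin; zero; suc; splitAt; punchIn; toℕ; _≟_)
open import Data.Sum using (_⊎_; inj₁; inj₂)
open import Data.Integer using (ℤ; +_; -_; _+_; _*_; _-_; -1ℤ; 0ℤ; 1ℤ)
open import Data.Integer using (_^_)
open import Relation.Nullary using (yes; no)

Matrix : ℕ → Set
Matrix n = Fin n → Fin n → ℤ

sumℤ : ∀ {n} → (Fin n → ℤ) → ℤ
sumℤ {zero}  f = 0ℤ
sumℤ {suc n} f = f zero + sumℤ (λ i → f (suc i))

sumℕ : ∀ {n} → (Fin n → ℕ) → ℕ
sumℕ {zero}  f = 0
sumℕ {suc n} f = f zero ℕ.+ sumℕ (λ i → f (suc i))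

det : ∀ {n} → Matrix n → ℤ
det {zero}  M = 1ℤ
det {suc n} M =
  sumℤ (λ j → ((-1ℤ) ^ toℕ j) * (M zero j * det (λ a b → M (suc a) (punchIn j b))))

idM : ∀ {n} → Matrix n
idM i j with i ≟ j
... | yes _ = 1ℤ
... | no  _ = 0ℤ

charPoly : ∀ {n} → Matrix n → ℤ → ℤ
charPoly M x = det (λ i j → x * idM i j - M i j)

-- Symmetric matrix of a bipartite (signed) graph on the vertex set
-- Fin k ⊎ Fin k ≅ Fin (k + k) (first k vertices = one part, last k = other part),
-- given the k × k biadjacency block B: entry (u_i, w_j) = B i j.
bipartiteMatrix : (k : ℕ) → (Fin k → Fin k → ℤ) → Matrix (k ℕ.+ k)
bipartiteMatrix k B u v with splitAt k u | splitAt k v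
... | inj₁ i | inj₂ j = B i j
... | inj₂ j | inj₁ i = B i j
... | _      | _      = 0ℤ

-- A signature on K_{k,k}: neg i j = true iff the edge u_i w_j is negative.
-- Adjacency matrix of the signed graph (K_{k,k}, σ).
signedKkkAdj : (k : ℕ) → (Fin k → Fin k → Bool) → Matrix (k ℕ.+ k)
signedKkkAdj k neg = bipartiteMatrix k (λ i j → if neg i j then -1ℤ else 1ℤ)

negGraphAdj : (k : ℕ) → (Fin k → Fin k → Bool) → Matrix (k ℕ.+ k)
negGraphAdj k neg = bipartiteMatrix k (λ i j → if neg i j then 1ℤ else 0ℤ)

-- H is r-regular of order 2k: every one of the 2k vertices is incident
-- to exactly r negative edges, and r ≥ 1 (so all 2k vertices lie in H).
negRegular : (k r : ℕ) → (Fin k → Fin k → Bool) → Set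
negRegular k r neg =
  (1 ℕ.≤ r)
  × ((i : Fin k) → sumℕ (λ j → if neg i j then 1 else 0) ≡ r)
  × ((j : Fin k) → sumℕ (λ i → if neg i j then 1 else 0) ≡ r)
  where
    open import Data.Product using (_×_)
    open import Relation.Binary.PropositionalEquality using (_≡_)

{-# OPTIONS --safe #-}
module Submission where

-- Write 𝟙ˡ, 𝟙ʳ for the indicator vectors of the two colour classes, N for the adjacency
-- matrix of H and J = 𝟙ˡ𝟙ʳᵀ + 𝟙ʳ𝟙ˡᵀ for that of K_{k,k}.  The signature gives A(Γ) = J − 2N,
-- so at x = −2y we have xI − A(Γ) = Q − J with Q = −2(yI − N), and det Q = 4^k det(yI − N).
-- By regularity, N swaps 𝟙ˡ and 𝟙ʳ up to the factor r, so Q and Q − J both map the plane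
-- span{𝟙ˡ, 𝟙ʳ} to itself by a matrix [[α, β], [β, α]], with (α, β) = (−2y, 2r) for Q and
-- (−2y, 2r − k) for Q − J.  For such a matrix X, Cramer's rule lets us replace one column from
-- each colour class by X𝟙ˡ and X𝟙ʳ, and bilinearity then gives det X = (α² − β²)·D_X, where D_X
-- is the determinant with those two columns replaced by 𝟙ˡ and 𝟙ʳ themselves.  Finally
-- D_{Q−J} = D_Q, because every other column of Q − J differs from that of Q by a combination
-- of 𝟙ˡ and 𝟙ʳ.  Eliminating D gives the identity.

open import Defs
open import Data.Bool using (Bool; true; false; if_then_else_)
open import Data.Empty using (⊥-elim)
open import Data.Fin using (Fin; zero; suc; toℕ; punchIn; punchOut; inject₁; splitAt; _↑ʳ_; _≟_)
open import Data.Fin.Properties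
  using (punchIn-injective; punchInᵢ≢i; punchIn-punchOut; toℕ-inject₁; toℕ-injective; suc-injective; splitAt-↑ʳ)
open import Data.Integer using (ℤ; +_; -_; _+_; _*_; _-_; _^_; 0ℤ; 1ℤ; -1ℤ; NonZero)
open import Data.Integer.Properties
  using (+-identityˡ; +-identityʳ; +-assoc; *-assoc; *-zeroʳ; *-identityˡ; *-identityʳ; *-distribˡ-+;
         *-cancelˡ-≡; +-commutativeSemigroup; +-0-abelianGroup)
open import Data.Integer.Tactic.RingSolver using (solve-∀)
open import Algebra.Properties.AbelianGroup +-0-abelianGroup using (inverseˡ-unique)
open import Algebra.Properties.CommutativeSemigroup +-commutativeSemigroup using (x∙yz≈y∙xz)
open import Data.List using ([]; _∷_; allFin)
open import Data.List.Membership.Propositional using (_∉_)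
open import Data.List.Membership.Propositional.Properties using (∈-allFin)
open import Data.List.Relation.Unary.Any using (here; there)
open import Data.Nat using (ℕ; zero; suc; _≤_; _∸_; s≤s)
import Data.Nat as ℕ
import Data.Nat.Properties as ℕ
open import Data.Product using (_×_; _,_)
import Data.Product as Product
open import Data.Sum using (_⊎_; inj₁; inj₂; [_,_]′)
import Data.Sum as Sum
open import Data.Vec.Functional using (updateAt)
open import Data.Vec.Functional.Properties using (updateAt-updates; updateAt-minimal; updateAt-id-local; updateAt-commutes)
open import Function using (_∘_; const)
open import Relation.Binary.Definitions using (tri<; tri≈; tri>)
open import Relation.Binary.PropositionalEquality
  using (_≡_; _≢_; refl; sym; trans; cong; cong₂; subst; module ≡-Reasoning)
open import Relation.Nullary using (yes; no; contradiction)

open ≡-Reasoning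

^-double : ∀ (x : ℤ) m → x ^ (m ℕ.+ m) ≡ (x * x) ^ m
^-double x zero    = refl
^-double x (suc m) = begin
  x * x ^ (m ℕ.+ suc m)     ≡⟨ cong (λ e → x * x ^ e) (ℕ.+-suc m m) ⟩
  x * (x * x ^ (m ℕ.+ m))   ≡⟨ *-assoc x x _ ⟨
  x * x * x ^ (m ℕ.+ m)     ≡⟨ cong (x * x *_) (^-double x m) ⟩
  x * x * (x * x) ^ m       ∎

eliminate-common-factor : ∀ (c : ℤ) .{{_ : NonZero c}} A z {m q d p : ℤ} →
                          m ≡ A * d → q ≡ c * z * d → q ≡ c * p → m * z ≡ A * p
eliminate-common-factor c A z {m = m} {d = d} {p = p} m≡Ad q≡czd q≡cp = begin
  m * z        ≡⟨ cong (_* z) m≡Ad ⟩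
  A * d * z    ≡⟨ rearrange A d z ⟩
  A * (z * d)  ≡⟨ cong (A *_) (*-cancelˡ-≡ c (z * d) p czd≡cp) ⟩
  A * p        ∎
  where
  rearrange : ∀ A d z → A * d * z ≡ A * (z * d)
  rearrange = solve-∀
  czd≡cp : c * (z * d) ≡ c * p
  czd≡cp = trans (sym (*-assoc c z d)) (trans (sym q≡czd) q≡cp)

sumℤ-cong : ∀ {n} {f g : Fin n → ℤ} → (∀ i → f i ≡ g i) → sumℤ f ≡ sumℤ g
sumℤ-cong {zero}  f≗g = refl
sumℤ-cong {suc n} f≗g = cong₂ _+_ (f≗g zero) (sumℤ-cong (f≗g ∘ suc))

sumℤ-zero : ∀ {n} {f : Fin n → ℤ} → (∀ i → f i ≡ 0ℤ) → sumℤ f ≡ 0ℤ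
sumℤ-zero {zero}  f≗0 = refl
sumℤ-zero {suc n} f≗0 = cong₂ _+_ (f≗0 zero) (sumℤ-zero (f≗0 ∘ suc))

sumℤ-+ : ∀ {n} (f g : Fin n → ℤ) → sumℤ (λ i → f i + g i) ≡ sumℤ f + sumℤ g
sumℤ-+ {zero}  f g = refl
sumℤ-+ {suc n} f g = begin
  f zero + g zero + sumℤ (λ i → f (suc i) + g (suc i))
    ≡⟨ cong (_+_ (f zero + g zero)) (sumℤ-+ (f ∘ suc) (g ∘ suc)) ⟩
  f zero + g zero + (sumℤ (f ∘ suc) + sumℤ (g ∘ suc))
    ≡⟨ interchange (f zero) (g zero) _ _ ⟩
  f zero + sumℤ (f ∘ suc) + (g zero + sumℤ (g ∘ suc)) ∎
  where
  interchange : ∀ a b c d → a + b + (c + d) ≡ a + c + (b + d)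
  interchange = solve-∀

sumℤ-*ˡ : ∀ {n} (s : ℤ) (f : Fin n → ℤ) → sumℤ (λ i → s * f i) ≡ s * sumℤ f
sumℤ-*ˡ {zero}  s f = sym (*-zeroʳ s)
sumℤ-*ˡ {suc n} s f = begin
  s * f zero + sumℤ (λ i → s * f (suc i)) ≡⟨ cong (_+_ (s * f zero)) (sumℤ-*ˡ s (f ∘ suc)) ⟩
  s * f zero + s * sumℤ (f ∘ suc)         ≡⟨ *-distribˡ-+ s (f zero) _ ⟨
  s * (f zero + sumℤ (f ∘ suc))           ∎

sumℤ-linear : ∀ {n} (s t : ℤ) (f g : Fin n → ℤ) →
              sumℤ (λ i → s * f i + t * g i) ≡ s * sumℤ f + t * sumℤ g
sumℤ-linear s t f g =
  trans (sumℤ-+ (λ i → s * f i) (λ i → t * g i)) (cong₂ _+_ (sumℤ-*ˡ s f) (sumℤ-*ˡ t g))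

sumℤ-ones : ∀ n → sumℤ {n} (const 1ℤ) ≡ + n
sumℤ-ones zero    = refl
sumℤ-ones (suc n) = cong (_+_ 1ℤ) (sumℤ-ones n)

sumℤ-ℕ : ∀ {n} (f : Fin n → ℕ) → sumℤ (λ i → + f i) ≡ + sumℕ f
sumℤ-ℕ {zero}  f = refl
sumℤ-ℕ {suc n} f = cong (_+_ (+ f zero)) (sumℤ-ℕ (f ∘ suc))

sumℤ-indicator : ∀ {n} (f : Fin n → Bool) →
                 sumℤ (λ i → if f i then 1ℤ else 0ℤ) ≡ + sumℕ (λ i → if f i then 1 else 0)
sumℤ-indicator f = trans (sumℤ-cong (indicator ∘ f)) (sumℤ-ℕ (λ i → if f i then 1 else 0))
  where
  indicator : ∀ β → (if β then 1ℤ else 0ℤ) ≡ + (if β then 1 else 0)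
  indicator true  = refl
  indicator false = refl

sumℤ-punchIn : ∀ {n} (p : Fin (suc n)) (f : Fin (suc n) → ℤ) → sumℤ f ≡ f p + sumℤ (f ∘ punchIn p)
sumℤ-punchIn zero            f = refl
sumℤ-punchIn {suc n} (suc p) f = begin
  f zero + sumℤ (f ∘ suc)                             ≡⟨ cong (_+_ (f zero)) (sumℤ-punchIn p (f ∘ suc)) ⟩
  f zero + (f (suc p) + sumℤ (f ∘ suc ∘ punchIn p))   ≡⟨ x∙yz≈y∙xz (f zero) (f (suc p)) _ ⟩
  f (suc p) + (f zero + sumℤ (f ∘ suc ∘ punchIn p))   ∎

sumℤ-single : ∀ {n} (p : Fin n) {f : Fin n → ℤ} → (∀ j → j ≢ p → f j ≡ 0ℤ) → sumℤ f ≡ f p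
sumℤ-single {suc n} p {f} f≗0 = begin
  sumℤ f                       ≡⟨ sumℤ-punchIn p f ⟩
  f p + sumℤ (f ∘ punchIn p)   ≡⟨ cong (_+_ (f p)) (sumℤ-zero (λ j → f≗0 (punchIn p j) (punchInᵢ≢i p j))) ⟩
  f p + 0ℤ                     ≡⟨ +-identityʳ (f p) ⟩
  f p                          ∎

punchIn-≢-punchOut : ∀ {n} {i k : Fin (suc n)} (i≢k : i ≢ k) {j : Fin n} →
                     j ≢ punchOut i≢k → punchIn i j ≢ k
punchIn-≢-punchOut {i = i} i≢k {j} j≢ eq = j≢ (punchIn-injective i j _ (trans eq (sym (punchIn-punchOut i≢k))))

sumℤ-pair : ∀ {n} {p q : Fin n} {f : Fin n → ℤ} → p ≢ q → (∀ j → j ≢ p → j ≢ q → f j ≡ 0ℤ) →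
            sumℤ f ≡ f p + f q
sumℤ-pair {suc n} {p} {q} {f} p≢q f≗0 = begin
  sumℤ f                                    ≡⟨ sumℤ-punchIn p f ⟩
  f p + sumℤ (f ∘ punchIn p)                ≡⟨ cong (_+_ (f p)) (sumℤ-single (punchOut p≢q) outside) ⟩
  f p + f (punchIn p (punchOut p≢q))        ≡⟨ cong (λ j → f p + f j) (punchIn-punchOut p≢q) ⟩
  f p + f q                                 ∎
  where
  outside : ∀ j → j ≢ punchOut p≢q → f (punchIn p j) ≡ 0ℤ
  outside j j≢ = f≗0 (punchIn p j) (punchInᵢ≢i p j) (punchIn-≢-punchOut p≢q j≢)

sumℤ-splitAt : ∀ m {n} (F : Fin m ⊎ Fin n → ℤ) →
               sumℤ (F ∘ splitAt m) ≡ sumℤ (F ∘ inj₁) + sumℤ (F ∘ inj₂)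
sumℤ-splitAt zero    F = sym (+-identityˡ _)
sumℤ-splitAt (suc m) F = begin
  F (inj₁ zero) + sumℤ (F ∘ Sum.map₁ suc ∘ splitAt m)
    ≡⟨ cong (_+_ (F (inj₁ zero))) (sumℤ-splitAt m (F ∘ Sum.map₁ suc)) ⟩
  F (inj₁ zero) + (sumℤ (F ∘ inj₁ ∘ suc) + sumℤ (F ∘ inj₂))
    ≡⟨ +-assoc (F (inj₁ zero)) _ _ ⟨
  F (inj₁ zero) + sumℤ (F ∘ inj₁ ∘ suc) + sumℤ (F ∘ inj₂) ∎

-- Laplace expansion along the first row

sgn : ∀ {n} → Fin n → ℤ
sgn j = -1ℤ ^ toℕ j

minor : ∀ {n} → Fin (suc n) → Matrix (suc n) → Matrix n
minor j X a b = X (suc a) (punchIn j b)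

-- det {suc n} X reduces to sumℤ (laplaceTerm X).
laplaceTerm : ∀ {n} → Matrix (suc n) → Fin (suc n) → ℤ
laplaceTerm X j = sgn j * (X zero j * det (minor j X))

det-cong : ∀ {n} {X Y : Matrix n} → (∀ i j → X i j ≡ Y i j) → det X ≡ det Y
det-cong {zero}  X≗Y = refl
det-cong {suc n} X≗Y = sumℤ-cong λ j →
  cong₂ (λ x d → sgn j * (x * d)) (X≗Y zero j) (det-cong (λ a b → X≗Y (suc a) (punchIn j b)))

minor-deleted-column : ∀ {n} (c : Fin (suc n)) {X Z : Matrix (suc n)} →
                       (∀ i l → l ≢ c → X i l ≡ Z i l) → ∀ a b → minor c X a b ≡ minor c Z a b
minor-deleted-column c X≈Z a b = X≈Z (suc a) (punchIn c b) (punchInᵢ≢i c b)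

minor-kept-column : ∀ {n} {j c : Fin (suc n)} (j≢c : j ≢ c) {X Z : Matrix (suc n)} →
                    (∀ i l → l ≢ c → X i l ≡ Z i l) →
                    ∀ a b → b ≢ punchOut j≢c → minor j X a b ≡ minor j Z a b
minor-kept-column {j = j} j≢c X≈Z a b b≢ = X≈Z (suc a) (punchIn j b) (punchIn-≢-punchOut j≢c b≢)

det-linear : ∀ {n} (c : Fin n) (s t : ℤ) {X A B : Matrix n} →
             (∀ i j → j ≢ c → X i j ≡ A i j) → (∀ i j → j ≢ c → X i j ≡ B i j) →
             (∀ i → X i c ≡ s * A i c + t * B i c) →
             det X ≡ s * det A + t * det B
det-linear {suc n} c s t {X} {A} {B} X≈A X≈B Xc =
  trans (sumℤ-cong term) (sumℤ-linear s t (laplaceTerm A) (laplaceTerm B))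
  where
  term : ∀ j → laplaceTerm X j ≡ s * laplaceTerm A j + t * laplaceTerm B j
  term j with j ≟ c
  ... | yes refl = begin
    sgn c * (X zero c * det (minor c X))
      ≡⟨ cong (λ x → sgn c * (x * det (minor c X))) (Xc zero) ⟩
    sgn c * ((s * A zero c + t * B zero c) * det (minor c X))
      ≡⟨ distribute (sgn c) s t (A zero c) (B zero c) (det (minor c X)) ⟩
    s * (sgn c * (A zero c * det (minor c X))) + t * (sgn c * (B zero c * det (minor c X)))
      ≡⟨ cong₂ (λ dA dB → s * (sgn c * (A zero c * dA)) + t * (sgn c * (B zero c * dB)))
               (det-cong (minor-deleted-column c X≈A)) (det-cong (minor-deleted-column c X≈B)) ⟩
    s * laplaceTerm A c + t * laplaceTerm B c ∎
    where
    distribute : ∀ σ s t a b d → σ * ((s * a + t * b) * d) ≡ s * (σ * (a * d)) + t * (σ * (b * d))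
    distribute = solve-∀
  ... | no j≢c = begin
    sgn j * (X zero j * det (minor j X))
      ≡⟨ cong (λ d → sgn j * (X zero j * d))
              (det-linear (punchOut j≢c) s t (minor-kept-column j≢c X≈A) (minor-kept-column j≢c X≈B)
                          minor-column) ⟩
    sgn j * (X zero j * (s * det (minor j A) + t * det (minor j B)))
      ≡⟨ distribute (sgn j) (X zero j) s t (det (minor j A)) (det (minor j B)) ⟩
    s * (sgn j * (X zero j * det (minor j A))) + t * (sgn j * (X zero j * det (minor j B)))
      ≡⟨ cong₂ (λ a b → s * (sgn j * (a * det (minor j A))) + t * (sgn j * (b * det (minor j B))))
               (X≈A zero j j≢c) (X≈B zero j j≢c) ⟩
    s * laplaceTerm A j + t * laplaceTerm B j ∎
    where
    minor-column : ∀ a → minor j X a (punchOut j≢c)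
                         ≡ s * minor j A a (punchOut j≢c) + t * minor j B a (punchOut j≢c)
    minor-column a = subst (λ l → X (suc a) l ≡ s * A (suc a) l + t * B (suc a) l)
                           (sym (punchIn-punchOut j≢c)) (Xc (suc a))
    distribute : ∀ σ x s t dA dB → σ * (x * (s * dA + t * dB)) ≡ s * (σ * (x * dA)) + t * (σ * (x * dB))
    distribute = solve-∀

det-scale : ∀ {n} (s : ℤ) (X : Matrix n) → det (λ i j → s * X i j) ≡ s ^ n * det X
det-scale {zero}  s X = refl
det-scale {suc n} s X = begin
  sumℤ (λ j → sgn j * ((s * X zero j) * det (λ a b → s * minor j X a b)))
    ≡⟨ sumℤ-cong (λ j → cong (λ d → sgn j * ((s * X zero j) * d)) (det-scale s (minor j X))) ⟩
  sumℤ (λ j → sgn j * ((s * X zero j) * (s ^ n * det (minor j X))))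
    ≡⟨ sumℤ-cong (λ j → collect (sgn j) s (X zero j) (s ^ n) (det (minor j X))) ⟩
  sumℤ (λ j → s * s ^ n * laplaceTerm X j)
    ≡⟨ sumℤ-*ˡ (s * s ^ n) (laplaceTerm X) ⟩
  s * s ^ n * det X ∎
  where
  collect : ∀ σ s x sⁿ d → σ * ((s * x) * (sⁿ * d)) ≡ s * sⁿ * (σ * (x * d))
  collect = solve-∀

setColumn : ∀ {n} → Fin n → (Fin n → ℤ) → Matrix n → Matrix n
setColumn c f X i = updateAt (X i) c (const (f i))

setColumn-≡ : ∀ {n} (c : Fin n) f X i → setColumn c f X i c ≡ f i
setColumn-≡ c f X i = updateAt-updates c (X i)

setColumn-≢ : ∀ {n} (c : Fin n) f X i {j} → j ≢ c → setColumn c f X i j ≡ X i j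
setColumn-≢ c f X i {j} j≢c = updateAt-minimal j c (X i) j≢c

setColumn-self : ∀ {n} (c : Fin n) (X : Matrix n) i j → setColumn c (λ i → X i c) X i j ≡ X i j
setColumn-self c X i = updateAt-id-local c (X i) refl

setColumn-cong : ∀ {n} (c : Fin n) {f g : Fin n → ℤ} {X Y : Matrix n} →
                 (∀ i → f i ≡ g i) → (∀ i j → X i j ≡ Y i j) →
                 ∀ i j → setColumn c f X i j ≡ setColumn c g Y i j
setColumn-cong c {f} {g} {X} {Y} f≗g X≗Y i j with j ≟ c
... | yes refl = trans (setColumn-≡ c f X i) (trans (f≗g i) (sym (setColumn-≡ c g Y i)))
... | no j≢c   = trans (setColumn-≢ c f X i j≢c) (trans (X≗Y i j) (sym (setColumn-≢ c g Y i j≢c)))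

det-setColumn-linear : ∀ {n} (c : Fin n) (s t : ℤ) (f g : Fin n → ℤ) (X : Matrix n) →
                       det (setColumn c (λ i → s * f i + t * g i) X)
                         ≡ s * det (setColumn c f X) + t * det (setColumn c g X)
det-setColumn-linear {n} c s t f g X = det-linear c s t (outside f) (outside g) column
  where
  F : Fin n → ℤ
  F i = s * f i + t * g i
  outside : ∀ h i j → j ≢ c → setColumn c F X i j ≡ setColumn c h X i j
  outside h i j j≢c = trans (setColumn-≢ c F X i j≢c) (sym (setColumn-≢ c h X i j≢c))
  column : ∀ i → setColumn c F X i c ≡ s * setColumn c f X i c + t * setColumn c g X i c
  column i = trans (setColumn-≡ c F X i)
                   (sym (cong₂ (λ a b → s * a + t * b) (setColumn-≡ c f X i) (setColumn-≡ c g X i)))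

det-setColumn-+ : ∀ {n} (c : Fin n) (f g : Fin n → ℤ) (X : Matrix n) →
                  det (setColumn c (λ i → f i + g i) X) ≡ det (setColumn c f X) + det (setColumn c g X)
det-setColumn-+ c f g X = begin
  det (setColumn c (λ i → f i + g i) X)
    ≡⟨ det-cong (setColumn-cong c (λ i → sym (cong₂ _+_ (*-identityˡ (f i)) (*-identityˡ (g i))))
                                (λ _ _ → refl)) ⟩
  det (setColumn c (λ i → 1ℤ * f i + 1ℤ * g i) X)
    ≡⟨ det-setColumn-linear c 1ℤ 1ℤ f g X ⟩
  1ℤ * det (setColumn c f X) + 1ℤ * det (setColumn c g X)
    ≡⟨ cong₂ _+_ (*-identityˡ (det (setColumn c f X))) (*-identityˡ (det (setColumn c g X))) ⟩
  det (setColumn c f X) + det (setColumn c g X) ∎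

det-setColumn-*ˡ : ∀ {n} (c : Fin n) (s : ℤ) (f : Fin n → ℤ) (X : Matrix n) →
                   det (setColumn c (λ i → s * f i) X) ≡ s * det (setColumn c f X)
det-setColumn-*ˡ c s f X = begin
  det (setColumn c (λ i → s * f i) X)
    ≡⟨ det-cong (setColumn-cong c (λ i → sym (+-identityʳ (s * f i))) (λ _ _ → refl)) ⟩
  det (setColumn c (λ i → s * f i + 0ℤ * f i) X)
    ≡⟨ det-setColumn-linear c s 0ℤ f f X ⟩
  s * det (setColumn c f X) + 0ℤ
    ≡⟨ +-identityʳ (s * det (setColumn c f X)) ⟩
  s * det (setColumn c f X) ∎

Alternating : ∀ {n} → Fin n → Fin n → Set
Alternating {n} p q = ∀ (X : Matrix n) → (∀ i → X i p ≡ X i q) → det X ≡ 0ℤ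

setColumns : ∀ {n} → Fin n → Fin n → (Fin n → ℤ) → (Fin n → ℤ) → Matrix n → Matrix n
setColumns p q f g X = setColumn q g (setColumn p f X)

module _ {n} {p q : Fin n} (p≢q : p ≢ q) where

  setColumns-p : ∀ f g X i → setColumns p q f g X i p ≡ f i
  setColumns-p f g X i = trans (setColumn-≢ q g (setColumn p f X) i p≢q) (setColumn-≡ p f X i)

  setColumns-q : ∀ f g X i → setColumns p q f g X i q ≡ g i
  setColumns-q f g X = setColumn-≡ q g (setColumn p f X)

  setColumns-≢ : ∀ f g X i {j} → j ≢ p → j ≢ q → setColumns p q f g X i j ≡ X i j
  setColumns-≢ f g X i j≢p j≢q = trans (setColumn-≢ q g (setColumn p f X) i j≢q) (setColumn-≢ p f X i j≢p)

  setColumns-outside : ∀ f g X X′ i j → (j ≢ p → j ≢ q → X i j ≡ X′ i j) →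
                       setColumns p q f g X i j ≡ setColumns p q f g X′ i j
  setColumns-outside f g X X′ i j X≡X′ with j ≟ p | j ≟ q
  ... | yes refl | _        = trans (setColumns-p f g X i) (sym (setColumns-p f g X′ i))
  ... | no _     | yes refl = trans (setColumns-q f g X i) (sym (setColumns-q f g X′ i))
  ... | no j≢p   | no j≢q   =
    trans (setColumns-≢ f g X i j≢p j≢q) (trans (X≡X′ j≢p j≢q) (sym (setColumns-≢ f g X′ i j≢p j≢q)))

  setColumns-comm : ∀ f g X i j → setColumns p q f g X i j ≡ setColumn p f (setColumn q g X) i j
  setColumns-comm f g X i = updateAt-commutes q p (p≢q ∘ sym) (X i)

  setColumns-self : ∀ X i j → setColumns p q (λ i → X i p) (λ i → X i q) X i j ≡ X i j
  setColumns-self X i j with j ≟ q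
  ... | yes refl = setColumn-≡ q (λ i → X i q) (setColumn p (λ i → X i p) X) i
  ... | no j≢q   = trans (setColumn-≢ q (λ i → X i q) (setColumn p (λ i → X i p) X) i j≢q)
                         (setColumn-self p X i j)

  det-setColumns-linearˡ : ∀ (s t : ℤ) f g h X →
    det (setColumns p q (λ i → s * f i + t * g i) h X)
      ≡ s * det (setColumns p q f h X) + t * det (setColumns p q g h X)
  det-setColumns-linearˡ s t f g h X = begin
    det (setColumns p q (λ i → s * f i + t * g i) h X)
      ≡⟨ det-cong (setColumns-comm _ h X) ⟩
    det (setColumn p (λ i → s * f i + t * g i) (setColumn q h X))
      ≡⟨ det-setColumn-linear p s t f g (setColumn q h X) ⟩
    s * det (setColumn p f (setColumn q h X)) + t * det (setColumn p g (setColumn q h X))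
      ≡⟨ cong₂ (λ a b → s * a + t * b) (det-cong (λ i j → sym (setColumns-comm f h X i j)))
                                       (det-cong (λ i j → sym (setColumns-comm g h X i j))) ⟩
    s * det (setColumns p q f h X) + t * det (setColumns p q g h X) ∎

  det-setColumns-linearʳ : ∀ (s t : ℤ) f g h X →
    det (setColumns p q h (λ i → s * f i + t * g i) X)
      ≡ s * det (setColumns p q h f X) + t * det (setColumns p q h g X)
  det-setColumns-linearʳ s t f g h X = det-setColumn-linear q s t f g (setColumn p h X)

  module _ (alt : Alternating p q) where

    det-setColumns-diagonal : ∀ f X → det (setColumns p q f f X) ≡ 0ℤ
    det-setColumns-diagonal f X = alt _ (λ i → trans (setColumns-p f f X i) (sym (setColumns-q f f X i)))

    det-setColumns-antisym : ∀ f g X → det (setColumns p q f g X) ≡ - det (setColumns p q g f X)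
    det-setColumns-antisym f g X =
      inverseˡ-unique (D f g) (D g f) (trans (sym expand) (det-setColumns-diagonal f+g X))
      where
      D : (Fin n → ℤ) → (Fin n → ℤ) → ℤ
      D f g = det (setColumns p q f g X)
      f+g : Fin n → ℤ
      f+g i = 1ℤ * f i + 1ℤ * g i
      simplify : ∀ a b → 1ℤ * (1ℤ * 0ℤ + 1ℤ * a) + 1ℤ * (1ℤ * b + 1ℤ * 0ℤ) ≡ a + b
      simplify = solve-∀
      expand : D f+g f+g ≡ D f g + D g f
      expand = begin
        D f+g f+g
          ≡⟨ det-setColumns-linearˡ 1ℤ 1ℤ f g f+g X ⟩
        1ℤ * D f f+g + 1ℤ * D g f+g
          ≡⟨ cong₂ (λ a b → 1ℤ * a + 1ℤ * b) (det-setColumns-linearʳ 1ℤ 1ℤ f g f X)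
                                             (det-setColumns-linearʳ 1ℤ 1ℤ f g g X) ⟩
        1ℤ * (1ℤ * D f f + 1ℤ * D f g) + 1ℤ * (1ℤ * D g f + 1ℤ * D g g)
          ≡⟨ cong₂ (λ a b → 1ℤ * (1ℤ * a + 1ℤ * D f g) + 1ℤ * (1ℤ * D g f + 1ℤ * b))
                   (det-setColumns-diagonal f X) (det-setColumns-diagonal g X) ⟩
        1ℤ * (1ℤ * 0ℤ + 1ℤ * D f g) + 1ℤ * (1ℤ * D g f + 1ℤ * 0ℤ)
          ≡⟨ simplify (D f g) (D g f) ⟩
        D f g + D g f ∎

    det-setColumns-hyperbolic : ∀ (α β : ℤ) u v X →
      det (setColumns p q (λ i → α * u i + β * v i) (λ i → α * v i + β * u i) X)
        ≡ (α * α - β * β) * det (setColumns p q u v X)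
    det-setColumns-hyperbolic α β u v X = begin
      D (λ i → α * u i + β * v i) g
        ≡⟨ det-setColumns-linearˡ α β u v g X ⟩
      α * D u g + β * D v g
        ≡⟨ cong₂ (λ a b → α * a + β * b) (det-setColumns-linearʳ α β v u u X)
                                         (det-setColumns-linearʳ α β v u v X) ⟩
      α * (α * D u v + β * D u u) + β * (α * D v v + β * D v u)
        ≡⟨ cong₂ (λ a b → α * (α * D u v + β * a) + β * (α * b + β * D v u))
                 (det-setColumns-diagonal u X) (det-setColumns-diagonal v X) ⟩
      α * (α * D u v + β * 0ℤ) + β * (α * 0ℤ + β * D v u)
        ≡⟨ cong (λ d → α * (α * D u v + β * 0ℤ) + β * (α * 0ℤ + β * d)) (det-setColumns-antisym v u X) ⟩
      α * (α * D u v + β * 0ℤ) + β * (α * 0ℤ + β * - D u v)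
        ≡⟨ simplify α β (D u v) ⟩
      (α * α - β * β) * D u v ∎
      where
      D : (Fin n → ℤ) → (Fin n → ℤ) → ℤ
      D f g = det (setColumns p q f g X)
      g : Fin n → ℤ
      g i = α * v i + β * u i
      simplify : ∀ α β d → α * (α * d + β * 0ℤ) + β * (α * 0ℤ + β * - d) ≡ (α * α - β * β) * d
      simplify = solve-∀

data Adjacent : ∀ {n} → Fin n → Fin n → Set where
  zero-one : ∀ {n} → Adjacent {suc (suc n)} zero (suc zero)
  suc-suc  : ∀ {n} {p q : Fin n} → Adjacent p q → Adjacent (suc p) (suc q)

inject₁-adjacent : ∀ {n} (i : Fin n) → Adjacent (inject₁ i) (suc i)
inject₁-adjacent zero    = zero-one
inject₁-adjacent (suc i) = suc-suc (inject₁-adjacent i)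

adjacent-toℕ : ∀ {n} {p q : Fin n} → Adjacent p q → toℕ q ≡ suc (toℕ p)
adjacent-toℕ zero-one    = refl
adjacent-toℕ (suc-suc a) = cong suc (adjacent-toℕ a)

adjacent-≢ : ∀ {n} {p q : Fin n} → Adjacent p q → p ≢ q
adjacent-≢ zero-one     ()
adjacent-≢ (suc-suc a) p≡q = adjacent-≢ a (suc-injective p≡q)

adjacent-punchOut : ∀ {n} {p q j : Fin (suc n)} → Adjacent p q → (j≢p : j ≢ p) (j≢q : j ≢ q) →
                    Adjacent (punchOut j≢p) (punchOut j≢q)
adjacent-punchOut                   {j = zero}        zero-one    j≢p _   = ⊥-elim (j≢p refl)
adjacent-punchOut                   {j = suc zero}    zero-one    _   j≢q = ⊥-elim (j≢q refl)
adjacent-punchOut {n = suc (suc n)} {j = suc (suc j)} zero-one    _   _   = zero-one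
adjacent-punchOut                   {j = zero}        (suc-suc a) _   _   = a
adjacent-punchOut {n = suc n}       {j = suc j}       (suc-suc a) j≢p j≢q =
  suc-suc (adjacent-punchOut a (j≢p ∘ cong suc) (j≢q ∘ cong suc))

adjacent-punchIn : ∀ {n} {p q : Fin (suc n)} → Adjacent p q → ∀ b →
                   punchIn p b ≡ punchIn q b ⊎ (punchIn p b ≡ q × punchIn q b ≡ p)
adjacent-punchIn zero-one    zero    = inj₂ (refl , refl)
adjacent-punchIn zero-one    (suc b) = inj₁ refl
adjacent-punchIn (suc-suc a) zero    = inj₁ refl
adjacent-punchIn (suc-suc a) (suc b) =
  Sum.map (cong suc) (Product.map (cong suc) (cong suc)) (adjacent-punchIn a b)

adjacent⇒alternating : ∀ {n} {p q : Fin n} → Adjacent p q → Alternating p q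
adjacent⇒alternating {suc n} {p} {q} adj X Xp≡Xq = begin
  det X
    ≡⟨ sumℤ-pair (adjacent-≢ adj) outside ⟩
  sgn p * (X zero p * det (minor p X)) + sgn q * (X zero q * det (minor q X))
    ≡⟨ cong₂ (λ σ d → sgn p * (X zero p * det (minor p X)) + σ * (X zero q * d))
             (cong (-1ℤ ^_) (adjacent-toℕ adj)) (det-cong same-minors) ⟩
  sgn p * (X zero p * det (minor p X)) + -1ℤ * sgn p * (X zero q * det (minor p X))
    ≡⟨ cong (λ x → sgn p * (X zero p * det (minor p X)) + -1ℤ * sgn p * (x * det (minor p X)))
            (sym (Xp≡Xq zero)) ⟩
  sgn p * (X zero p * det (minor p X)) + -1ℤ * sgn p * (X zero p * det (minor p X))
    ≡⟨ cancel (sgn p) (X zero p * det (minor p X)) ⟩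
  0ℤ ∎
  where
  cancel : ∀ σ t → σ * t + -1ℤ * σ * t ≡ 0ℤ
  cancel = solve-∀
  outside : ∀ j → j ≢ p → j ≢ q → laplaceTerm X j ≡ 0ℤ
  outside j j≢p j≢q = begin
    sgn j * (X zero j * det (minor j X))
      ≡⟨ cong (λ d → sgn j * (X zero j * d))
              (adjacent⇒alternating (adjacent-punchOut adj j≢p j≢q) (minor j X) equal-columns) ⟩
    sgn j * (X zero j * 0ℤ)
      ≡⟨ cong (sgn j *_) (*-zeroʳ (X zero j)) ⟩
    sgn j * 0ℤ
      ≡⟨ *-zeroʳ (sgn j) ⟩
    0ℤ ∎
    where
    equal-columns : ∀ a → X (suc a) (punchIn j (punchOut j≢p)) ≡ X (suc a) (punchIn j (punchOut j≢q))
    equal-columns a = begin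
      X (suc a) (punchIn j (punchOut j≢p)) ≡⟨ cong (X (suc a)) (punchIn-punchOut j≢p) ⟩
      X (suc a) p                          ≡⟨ Xp≡Xq (suc a) ⟩
      X (suc a) q                          ≡⟨ cong (X (suc a)) (punchIn-punchOut j≢q) ⟨
      X (suc a) (punchIn j (punchOut j≢q)) ∎
  same-minors : ∀ a b → minor q X a b ≡ minor p X a b
  same-minors a b with adjacent-punchIn adj b
  ... | inj₁ p↑b≡q↑b         = cong (X (suc a)) (sym p↑b≡q↑b)
  ... | inj₂ (p↑b≡q , q↑b≡p) = begin
    X (suc a) (punchIn q b) ≡⟨ cong (X (suc a)) q↑b≡p ⟩
    X (suc a) p             ≡⟨ Xp≡Xq (suc a) ⟩
    X (suc a) q             ≡⟨ cong (X (suc a)) p↑b≡q ⟨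
    X (suc a) (punchIn p b) ∎

-- Swapping column q with its left neighbour q′ brings the copy of column p one step closer.
alternating-at-distance : ∀ d {n} {p q : Fin n} → suc (d ℕ.+ toℕ p) ≡ toℕ q → Alternating p q
alternating-at-distance d       {q = zero}   ()
alternating-at-distance zero    {p = p} {q = suc q₀} gap =
  subst (λ p → Alternating p (suc q₀)) (toℕ-injective (trans (toℕ-inject₁ q₀) (sym (ℕ.suc-injective gap))))
        (adjacent⇒alternating (inject₁-adjacent q₀))
alternating-at-distance (suc d) {p = p} {q = suc q₀} gap X Xp≡Xq = begin
  det X
    ≡⟨ det-cong (setColumns-self q′≢q X) ⟨
  det (setColumns q′ q (column q′) (column q) X)
    ≡⟨ det-setColumns-antisym q′≢q (adjacent⇒alternating adj) (column q′) (column q) X ⟩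
  - det Y
    ≡⟨ cong -_ (alternating-at-distance d gap′ Y Y-equal) ⟩
  - 0ℤ ∎
  where
  q q′ : Fin _
  q  = suc q₀
  q′ = inject₁ q₀
  adj : Adjacent q′ q
  adj = inject₁-adjacent q₀
  q′≢q : q′ ≢ q
  q′≢q = adjacent-≢ adj
  column : Fin _ → Fin _ → ℤ
  column j i = X i j
  gap′ : suc (d ℕ.+ toℕ p) ≡ toℕ q′
  gap′ = trans (ℕ.suc-injective gap) (sym (toℕ-inject₁ q₀))
  p≢q′ : p ≢ q′
  p≢q′ p≡q′ = ℕ.<-irrefl (cong toℕ p≡q′) (ℕ.≤-trans (ℕ.s≤s (ℕ.m≤n+m _ d)) (ℕ.≤-reflexive gap′))
  p≢q : p ≢ q
  p≢q p≡q = ℕ.<-irrefl (cong toℕ p≡q) (ℕ.≤-trans (ℕ.s≤s (ℕ.m≤n+m _ (suc d))) (ℕ.≤-reflexive gap))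
  Y : Matrix _
  Y = setColumns q′ q (column q) (column q′) X
  Y-equal : ∀ i → Y i p ≡ Y i q′
  Y-equal i = begin
    Y i p   ≡⟨ setColumns-≢ q′≢q (column q) (column q′) X i p≢q′ p≢q ⟩
    X i p   ≡⟨ Xp≡Xq i ⟩
    X i q   ≡⟨ setColumns-p q′≢q (column q) (column q′) X i ⟨
    Y i q′  ∎

det-alternating : ∀ {n} {p q : Fin n} → p ≢ q → Alternating p q
det-alternating {p = p} {q} p≢q with ℕ.<-cmp (toℕ p) (toℕ q)
... | tri< p<q _ _ = let d , eq = ℕ.m≤n⇒∃[o]m+o≡n p<q in
                     alternating-at-distance d (trans (cong suc (ℕ.+-comm d (toℕ p))) eq)
... | tri≈ _ p≡q _ = ⊥-elim (p≢q (toℕ-injective p≡q))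
... | tri> _ _ q<p = let d , eq = ℕ.m≤n⇒∃[o]m+o≡n q<p in
                     λ X Xp≡Xq →
                       alternating-at-distance d (trans (cong suc (ℕ.+-comm d (toℕ q))) eq) X (sym ∘ Xp≡Xq)

-- Column operations and Cramer's rule

infixl 7 _*ᵥ_
_*ᵥ_ : ∀ {n} → Matrix n → (Fin n → ℤ) → Fin n → ℤ
(X *ᵥ w) i = sumℤ (λ j → w j * X i j)

*ᵥ-linear : ∀ {n} (α β : ℤ) (X Y : Matrix n) w i →
            ((λ i j → α * X i j + β * Y i j) *ᵥ w) i ≡ α * (X *ᵥ w) i + β * (Y *ᵥ w) i
*ᵥ-linear α β X Y w i = trans (sumℤ-cong (λ j → distribute (w j) α β (X i j) (Y i j)))
                              (sumℤ-linear α β (λ j → w j * X i j) (λ j → w j * Y i j))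
  where
  distribute : ∀ w α β x y → w * (α * x + β * y) ≡ α * (w * x) + β * (w * y)
  distribute = solve-∀

idM-*ᵥ : ∀ {n} (w : Fin n → ℤ) i → (idM *ᵥ w) i ≡ w i
idM-*ᵥ w i = trans (sumℤ-single i off-diagonal) (trans (cong (w i *_) (idM-diagonal i)) (*-identityʳ (w i)))
  where
  idM-diagonal : ∀ {n} (i : Fin n) → idM i i ≡ 1ℤ
  idM-diagonal i with i ≟ i
  ... | yes _   = refl
  ... | no i≢i = ⊥-elim (i≢i refl)
  off-diagonal : ∀ j → j ≢ i → w j * idM i j ≡ 0ℤ
  off-diagonal j j≢i with i ≟ j
  ... | yes i≡j = ⊥-elim (j≢i (sym i≡j))
  ... | no _    = *-zeroʳ (w j)

*ᵥ-rankTwo : ∀ {n} (M Q : Matrix n) (u v s t : Fin n → ℤ) →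
             (∀ i j → M i j ≡ Q i j - (s j * u i + t j * v i)) →
             ∀ w i → (M *ᵥ w) i ≡ (Q *ᵥ w) i - (sumℤ (λ j → w j * s j) * u i + sumℤ (λ j → w j * t j) * v i)
*ᵥ-rankTwo M Q u v s t M≡ w i = begin
  sumℤ (λ j → w j * M i j)
    ≡⟨ sumℤ-cong (λ j → trans (cong (w j *_) (M≡ i j)) (expand (w j) (Q i j) (s j) (t j) (u i) (v i))) ⟩
  sumℤ (λ j → w j * Q i j + (- u i * (w j * s j) + - v i * (w j * t j)))
    ≡⟨ sumℤ-+ (λ j → w j * Q i j) _ ⟩
  (Q *ᵥ w) i + sumℤ (λ j → - u i * (w j * s j) + - v i * (w j * t j))
    ≡⟨ cong (_+_ ((Q *ᵥ w) i)) (sumℤ-linear (- u i) (- v i) (λ j → w j * s j) (λ j → w j * t j)) ⟩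
  (Q *ᵥ w) i + (- u i * sumℤ (λ j → w j * s j) + - v i * sumℤ (λ j → w j * t j))
    ≡⟨ collect ((Q *ᵥ w) i) (u i) (v i) _ _ ⟩
  (Q *ᵥ w) i - (sumℤ (λ j → w j * s j) * u i + sumℤ (λ j → w j * t j) * v i) ∎
  where
  expand : ∀ w q s t u v → w * (q - (s * u + t * v)) ≡ w * q + (- u * (w * s) + - v * (w * t))
  expand = solve-∀
  collect : ∀ x u v σ τ → x + (- u * σ + - v * τ) ≡ x - (σ * u + τ * v)
  collect = solve-∀

*ᵥ-setColumn : ∀ {n} (c : Fin n) (w : Fin n → ℤ) → w c ≡ 0ℤ →
               ∀ f X i → (setColumn c f X *ᵥ w) i ≡ (X *ᵥ w) i
*ᵥ-setColumn c w wc≡0 f X i = sumℤ-cong term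
  where
  term : ∀ j → w j * setColumn c f X i j ≡ w j * X i j
  term j with j ≟ c
  ... | yes refl = trans (cong (_* setColumn c f X i c) wc≡0) (sym (cong (_* X i c) wc≡0))
  ... | no j≢c   = cong (w j *_) (setColumn-≢ c f X i j≢c)

det-setColumn-copy : ∀ {n} {c d : Fin n} → c ≢ d → ∀ X → det (setColumn c (λ i → X i d) X) ≡ 0ℤ
det-setColumn-copy {c = c} {d} c≢d X = det-alternating c≢d _ λ i →
  trans (setColumn-≡ c (λ i → X i d) X i) (sym (setColumn-≢ c (λ i → X i d) X i (c≢d ∘ sym)))

det-subtractColumns : ∀ {n} {c d₀ d₁ : Fin n} → c ≢ d₀ → c ≢ d₁ → ∀ (α β : ℤ) f X →
                      det (setColumn c (λ i → f i - (α * X i d₀ + β * X i d₁)) X) ≡ det (setColumn c f X)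
det-subtractColumns {c = c} {d₀} {d₁} c≢d₀ c≢d₁ α β f X = begin
  det (setColumn c (λ i → f i - g i) X)
    ≡⟨ det-cong (setColumn-cong c (λ i → as-combination (f i) (g i)) (λ _ _ → refl)) ⟩
  det (setColumn c (λ i → 1ℤ * f i + -1ℤ * g i) X)
    ≡⟨ det-setColumn-linear c 1ℤ -1ℤ f g X ⟩
  1ℤ * det (setColumn c f X) + -1ℤ * det (setColumn c g X)
    ≡⟨ cong (λ d → 1ℤ * det (setColumn c f X) + -1ℤ * d) (det-setColumn-linear c α β _ _ X) ⟩
  1ℤ * det (setColumn c f X) + -1ℤ * (α * det (copy d₀) + β * det (copy d₁))
    ≡⟨ cong₂ (λ a b → 1ℤ * det (setColumn c f X) + -1ℤ * (α * a + β * b))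
             (det-setColumn-copy c≢d₀ X) (det-setColumn-copy c≢d₁ X) ⟩
  1ℤ * det (setColumn c f X) + -1ℤ * (α * 0ℤ + β * 0ℤ)
    ≡⟨ simplify α β (det (setColumn c f X)) ⟩
  det (setColumn c f X) ∎
  where
  g : Fin _ → ℤ
  g i = α * X i d₀ + β * X i d₁
  copy : Fin _ → Matrix _
  copy d = setColumn c (λ i → X i d) X
  as-combination : ∀ a b → a - b ≡ 1ℤ * a + -1ℤ * b
  as-combination = solve-∀
  simplify : ∀ α β d → 1ℤ * d + -1ℤ * (α * 0ℤ + β * 0ℤ) ≡ d
  simplify = solve-∀

det-setColumn-sum : ∀ {m n} (c : Fin n) (g : Fin m → Fin n → ℤ) (X : Matrix n) →
                    det (setColumn c (λ i → sumℤ (λ j → g j i)) X) ≡ sumℤ (λ j → det (setColumn c (g j) X))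
det-setColumn-sum {zero}  c g X = det-setColumn-*ˡ c 0ℤ (const 0ℤ) X  -- 0ℤ * x reduces to 0ℤ
det-setColumn-sum {suc m} c g X =
  trans (det-setColumn-+ c (g zero) (λ i → sumℤ (λ j → g (suc j) i)) X)
        (cong (_+_ (det (setColumn c (g zero) X))) (det-setColumn-sum c (g ∘ suc) X))

det-setColumn-*ᵥ : ∀ {n} (c : Fin n) (w : Fin n → ℤ) (X : Matrix n) → det (setColumn c (X *ᵥ w) X) ≡ w c * det X
det-setColumn-*ᵥ c w X = begin
  det (setColumn c (X *ᵥ w) X)                        ≡⟨ det-setColumn-sum c (λ j i → w j * X i j) X ⟩
  sumℤ (λ j → det (setColumn c (λ i → w j * X i j) X)) ≡⟨ sumℤ-single c others ⟩
  det (setColumn c (λ i → w c * X i c) X)              ≡⟨ det-setColumn-*ˡ c (w c) (λ i → X i c) X ⟩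
  w c * det (setColumn c (λ i → X i c) X)              ≡⟨ cong (w c *_) (det-cong (setColumn-self c X)) ⟩
  w c * det X                                          ∎
  where
  others : ∀ j → j ≢ c → det (setColumn c (λ i → w j * X i j) X) ≡ 0ℤ
  others j j≢c = begin
    det (setColumn c (λ i → w j * X i j) X) ≡⟨ det-setColumn-*ˡ c (w j) (λ i → X i j) X ⟩
    w j * det (setColumn c (λ i → X i j) X) ≡⟨ cong (w j *_) (det-setColumn-copy (j≢c ∘ sym) X) ⟩
    w j * 0ℤ                                ≡⟨ *-zeroʳ (w j) ⟩
    0ℤ                                      ∎

det-setColumns-*ᵥ : ∀ {n} {c₀ c₁ : Fin n} (u v : Fin n → ℤ) →
                    u c₀ ≡ 1ℤ → v c₀ ≡ 0ℤ → v c₁ ≡ 1ℤ → ∀ X →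
                    det X ≡ det (setColumns c₀ c₁ (X *ᵥ u) (X *ᵥ v) X)
det-setColumns-*ᵥ {c₀ = c₀} {c₁} u v u₀≡1 v₀≡0 v₁≡1 X = begin
  det X                                          ≡⟨ *-identityˡ (det X) ⟨
  1ℤ * det X                                     ≡⟨ cong (_* det X) u₀≡1 ⟨
  u c₀ * det X                                   ≡⟨ det-setColumn-*ᵥ c₀ u X ⟨
  det X₁                                         ≡⟨ *-identityˡ (det X₁) ⟨
  1ℤ * det X₁                                    ≡⟨ cong (_* det X₁) v₁≡1 ⟨
  v c₁ * det X₁                                  ≡⟨ det-setColumn-*ᵥ c₁ v X₁ ⟨
  det (setColumn c₁ (X₁ *ᵥ v) X₁)                ≡⟨ det-cong (setColumn-cong c₁ X₁v≡Xv (λ _ _ → refl)) ⟩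
  det (setColumns c₀ c₁ (X *ᵥ u) (X *ᵥ v) X)    ∎
  where
  X₁ : Matrix _
  X₁ = setColumn c₀ (X *ᵥ u) X
  X₁v≡Xv : ∀ i → (X₁ *ᵥ v) i ≡ (X *ᵥ v) i
  X₁v≡Xv = *ᵥ-setColumn c₀ v v₀≡0 (X *ᵥ u) X

setColumns-cong : ∀ {n} (p q : Fin n) {f f′ g g′ : Fin n → ℤ} {X Y : Matrix n} →
                  (∀ i → f i ≡ f′ i) → (∀ i → g i ≡ g′ i) → (∀ i j → X i j ≡ Y i j) →
                  ∀ i j → setColumns p q f g X i j ≡ setColumns p q f′ g′ Y i j
setColumns-cong p q f≗f′ g≗g′ X≗Y = setColumn-cong q g≗g′ (setColumn-cong p f≗f′ X≗Y)

det-invariantPlane : ∀ {n} (c₀ c₁ : Fin n) → c₀ ≢ c₁ → (u v : Fin n → ℤ) →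
                     u c₀ ≡ 1ℤ → v c₀ ≡ 0ℤ → v c₁ ≡ 1ℤ → ∀ (α β : ℤ) X →
                     (∀ i → (X *ᵥ u) i ≡ α * u i + β * v i) → (∀ i → (X *ᵥ v) i ≡ α * v i + β * u i) →
                     det X ≡ (α * α - β * β) * det (setColumns c₀ c₁ u v X)
det-invariantPlane c₀ c₁ c₀≢c₁ u v u₀≡1 v₀≡0 v₁≡1 α β X Xu Xv = begin
  det X
    ≡⟨ det-setColumns-*ᵥ u v u₀≡1 v₀≡0 v₁≡1 X ⟩
  det (setColumns c₀ c₁ (X *ᵥ u) (X *ᵥ v) X)
    ≡⟨ det-cong (setColumns-cong c₀ c₁ Xu Xv (λ _ _ → refl)) ⟩
  det (setColumns c₀ c₁ (λ i → α * u i + β * v i) (λ i → α * v i + β * u i) X)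
    ≡⟨ det-setColumns-hyperbolic c₀≢c₁ (det-alternating c₀≢c₁) α β u v X ⟩
  (α * α - β * β) * det (setColumns c₀ c₁ u v X) ∎

-- Invariance under rank-two updates

module _ {n} (c₀ c₁ : Fin n) (c₀≢c₁ : c₀ ≢ c₁) (u v : Fin n → ℤ) (Y : Matrix n) where

  private
    perturb : (Fin n → ℤ) → (Fin n → ℤ) → Matrix n
    perturb s t i j = Y i j - (s j * u i + t j * v i)

    clear : Fin n → (Fin n → ℤ) → Fin n → ℤ
    clear c s = updateAt s c (const 0ℤ)

    perturb-clear : ∀ c s t i {j} → j ≢ c → perturb s t i j ≡ perturb (clear c s) (clear c t) i j
    perturb-clear c s t i {j} j≢c = sym (cong₂ (λ a b → Y i j - (a * u i + b * v i))
                                               (updateAt-minimal j c s j≢c) (updateAt-minimal j c t j≢c))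

    -- Column c changes by s c · u + t c · v, a combination of columns c₀ and c₁.
    det-clear-other : ∀ c s t → c ≢ c₀ → c ≢ c₁ →
                      det (setColumns c₀ c₁ u v (perturb s t))
                        ≡ det (setColumns c₀ c₁ u v (perturb (clear c s) (clear c t)))
    det-clear-other c s t c≢c₀ c≢c₁ = begin
      det Z                               ≡⟨ det-cong Z≡ ⟩
      det (setColumn c F Z′)              ≡⟨ det-subtractColumns c≢c₀ c≢c₁ (s c) (t c) (λ i → Z′ i c) Z′ ⟩
      det (setColumn c (λ i → Z′ i c) Z′) ≡⟨ det-cong (setColumn-self c Z′) ⟩
      det Z′                              ∎
      where
      P P′ Z Z′ : Matrix n
      P  = perturb s t
      P′ = perturb (clear c s) (clear c t)
      Z  = setColumns c₀ c₁ u v P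
      Z′ = setColumns c₀ c₁ u v P′
      F : Fin n → ℤ
      F i = Z′ i c - (s c * Z′ i c₀ + t c * Z′ i c₁)
      Z≡ : ∀ i j → Z i j ≡ setColumn c F Z′ i j
      Z≡ i j with j ≟ c
      ... | no j≢c   = trans (setColumns-outside c₀≢c₁ u v P P′ i j (λ _ _ → perturb-clear c s t i j≢c))
                             (sym (setColumn-≢ c F Z′ i j≢c))
      ... | yes refl = begin
        Z i c
          ≡⟨ setColumns-≢ c₀≢c₁ u v P i c≢c₀ c≢c₁ ⟩
        Y i c - (s c * u i + t c * v i)
          ≡⟨ cong (_- (s c * u i + t c * v i)) P′-c ⟨
        P′ i c - (s c * u i + t c * v i)
          ≡⟨ cong₂ _-_ (setColumns-≢ c₀≢c₁ u v P′ i c≢c₀ c≢c₁)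
                       (cong₂ (λ a b → s c * a + t c * b) (setColumns-p c₀≢c₁ u v P′ i)
                                                          (setColumns-q c₀≢c₁ u v P′ i)) ⟨
        Z′ i c - (s c * Z′ i c₀ + t c * Z′ i c₁)
          ≡⟨ setColumn-≡ c F Z′ i ⟨
        setColumn c F Z′ i c ∎
        where
        P′-c : P′ i c ≡ Y i c
        P′-c = trans (cong₂ (λ a b → Y i c - (a * u i + b * v i)) (updateAt-updates c s) (updateAt-updates c t))
                     (+-identityʳ (Y i c))

    det-clear : ∀ c s t → det (setColumns c₀ c₁ u v (perturb s t))
                          ≡ det (setColumns c₀ c₁ u v (perturb (clear c s) (clear c t)))
    det-clear c s t with c ≟ c₀ | c ≟ c₁
    ... | yes refl | _        = det-cong λ i j →
      setColumns-outside c₀≢c₁ u v (perturb s t) (perturb (clear c₀ s) (clear c₀ t)) i j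
                         (λ j≢c₀ _ → perturb-clear c₀ s t i j≢c₀)
    ... | no _     | yes refl = det-cong λ i j →
      setColumns-outside c₀≢c₁ u v (perturb s t) (perturb (clear c₁ s) (clear c₁ t)) i j
                         (λ _ j≢c₁ → perturb-clear c₁ s t i j≢c₁)
    ... | no c≢c₀  | no c≢c₁  = det-clear-other c s t c≢c₀ c≢c₁

    det-perturb-supported : ∀ cs s t → (∀ j → j ∉ cs → s j ≡ 0ℤ × t j ≡ 0ℤ) →
                            det (setColumns c₀ c₁ u v (perturb s t)) ≡ det (setColumns c₀ c₁ u v Y)
    det-perturb-supported []       s t vanish =
      det-cong (setColumns-cong c₀ c₁ (λ _ → refl) (λ _ → refl) unperturbed)
      where
      unperturbed : ∀ i j → perturb s t i j ≡ Y i j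
      unperturbed i j with vanish j (λ ())
      ... | s≡0 , t≡0 = trans (cong₂ (λ a b → Y i j - (a * u i + b * v i)) s≡0 t≡0) (+-identityʳ (Y i j))
    det-perturb-supported (c ∷ cs) s t vanish =
      trans (det-clear c s t) (det-perturb-supported cs (clear c s) (clear c t) vanish′)
      where
      vanish′ : ∀ j → j ∉ cs → clear c s j ≡ 0ℤ × clear c t j ≡ 0ℤ
      vanish′ j j∉cs with j ≟ c
      ... | yes refl = updateAt-updates c s , updateAt-updates c t
      ... | no j≢c   with vanish j (λ { (here j≡c) → j≢c j≡c ; (there j∈cs) → j∉cs j∈cs })
      ...   | s≡0 , t≡0 = trans (updateAt-minimal j c s j≢c) s≡0 , trans (updateAt-minimal j c t j≢c) t≡0

  det-setColumns-rankTwo : ∀ (s t : Fin n → ℤ) X → (∀ i j → X i j ≡ Y i j - (s j * u i + t j * v i)) →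
                           det (setColumns c₀ c₁ u v X) ≡ det (setColumns c₀ c₁ u v Y)
  det-setColumns-rankTwo s t X X≡ =
    trans (det-cong (setColumns-cong c₀ c₁ (λ _ → refl) (λ _ → refl) X≡))
          (det-perturb-supported (allFin n) s t λ j j∉ → contradiction (∈-allFin j) j∉)

-- Signed complete bipartite graphs

χˡ χʳ : ∀ {m n} → Fin m ⊎ Fin n → ℤ
χˡ = [ const 1ℤ , const 0ℤ ]′
χʳ = [ const 0ℤ , const 1ℤ ]′

bipartite⊎ : ∀ {k} → (Fin k → Fin k → ℤ) → Fin k ⊎ Fin k → Fin k ⊎ Fin k → ℤ
bipartite⊎ B (inj₁ a) (inj₂ b) = B a b
bipartite⊎ B (inj₂ b) (inj₁ a) = B a b
bipartite⊎ B (inj₁ _) (inj₁ _) = 0ℤ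
bipartite⊎ B (inj₂ _) (inj₂ _) = 0ℤ

bipartiteMatrix-splitAt : ∀ k B i j → bipartiteMatrix k B i j ≡ bipartite⊎ B (splitAt k i) (splitAt k j)
bipartiteMatrix-splitAt k B i j with splitAt k i | splitAt k j
... | inj₁ _ | inj₁ _ = refl
... | inj₁ _ | inj₂ _ = refl
... | inj₂ _ | inj₁ _ = refl
... | inj₂ _ | inj₂ _ = refl

bipartite-*ᵥ : ∀ k B (w : Fin k ⊎ Fin k → ℤ) i →
               (bipartiteMatrix k B *ᵥ (w ∘ splitAt k)) i
                 ≡ sumℤ (λ a → w (inj₁ a) * bipartite⊎ B (splitAt k i) (inj₁ a))
                   + sumℤ (λ b → w (inj₂ b) * bipartite⊎ B (splitAt k i) (inj₂ b))
bipartite-*ᵥ k B w i =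
  trans (sumℤ-cong (λ j → cong (w (splitAt k j) *_) (bipartiteMatrix-splitAt k B i j)))
        (sumℤ-splitAt k (λ x → w x * bipartite⊎ B (splitAt k i) x))

bipartite-*ᵥ-χˡ : ∀ k B {c} → (∀ b → sumℤ (λ a → B a b) ≡ c) → ∀ i →
                  (bipartiteMatrix k B *ᵥ (χˡ ∘ splitAt k)) i ≡ c * χʳ (splitAt k i)
bipartite-*ᵥ-χˡ k B {c} colSum i = trans (bipartite-*ᵥ k B χˡ i) (by-side (splitAt k i))
  where
  by-side : ∀ x → sumℤ (λ a → 1ℤ * bipartite⊎ B x (inj₁ a)) + sumℤ {k} (const 0ℤ) ≡ c * χʳ x
  by-side (inj₁ _) =
    trans (cong₂ _+_ (sumℤ-zero {k} (λ _ → refl)) (sumℤ-zero {k} (λ _ → refl))) (sym (*-zeroʳ c))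
  by-side (inj₂ b) = begin
    sumℤ (λ a → 1ℤ * B a b) + sumℤ {k} (const 0ℤ)
      ≡⟨ cong₂ _+_ (sumℤ-cong (λ a → *-identityˡ (B a b))) (sumℤ-zero {k} (λ _ → refl)) ⟩
    sumℤ (λ a → B a b) + 0ℤ  ≡⟨ +-identityʳ _ ⟩
    sumℤ (λ a → B a b)       ≡⟨ colSum b ⟩
    c                        ≡⟨ *-identityʳ c ⟨
    c * 1ℤ                   ∎

bipartite-*ᵥ-χʳ : ∀ k B {c} → (∀ a → sumℤ (λ b → B a b) ≡ c) → ∀ i →
                  (bipartiteMatrix k B *ᵥ (χʳ ∘ splitAt k)) i ≡ c * χˡ (splitAt k i)
bipartite-*ᵥ-χʳ k B {c} rowSum i = trans (bipartite-*ᵥ k B χʳ i) (by-side (splitAt k i))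
  where
  by-side : ∀ x → sumℤ {k} (const 0ℤ) + sumℤ (λ b → 1ℤ * bipartite⊎ B x (inj₂ b)) ≡ c * χˡ x
  by-side (inj₂ _) =
    trans (cong₂ _+_ (sumℤ-zero {k} (λ _ → refl)) (sumℤ-zero {k} (λ _ → refl))) (sym (*-zeroʳ c))
  by-side (inj₁ a) = begin
    sumℤ {k} (const 0ℤ) + sumℤ (λ b → 1ℤ * B a b)
      ≡⟨ cong₂ _+_ (sumℤ-zero {k} (λ _ → refl)) (sumℤ-cong (λ b → *-identityˡ (B a b))) ⟩
    0ℤ + sumℤ (λ b → B a b)  ≡⟨ +-identityˡ _ ⟩
    sumℤ (λ b → B a b)       ≡⟨ rowSum a ⟩
    c                        ≡⟨ *-identityʳ c ⟨
    c * 1ℤ                   ∎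

module SignedCompleteBipartite (k r : ℕ) (neg : Fin k → Fin k → Bool)
  (rowDegree    : ∀ a → sumℕ (λ b → if neg a b then 1 else 0) ≡ r)
  (columnDegree : ∀ b → sumℕ (λ a → if neg a b then 1 else 0) ≡ r)
  (y : ℤ) where

  𝟙ˡ 𝟙ʳ : Fin (k ℕ.+ k) → ℤ
  𝟙ˡ = χˡ ∘ splitAt k
  𝟙ʳ = χʳ ∘ splitAt k

  N S P Q M : Matrix (k ℕ.+ k)
  N = negGraphAdj k neg
  S = signedKkkAdj k neg
  -- charPoly N y = det P and charPoly S (- (+ 2 * y)) = det M
  P i j = y * idM i j - N i j
  Q i j = - + 2 * P i j
  M i j = - (+ 2 * y) * idM i j - S i j

  S≡J-2N : ∀ i j → S i j ≡ (𝟙ʳ j * 𝟙ˡ i + 𝟙ˡ j * 𝟙ʳ i) - + 2 * N i j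
  S≡J-2N i j with splitAt k i | splitAt k j
  ... | inj₁ _ | inj₁ _ = refl
  ... | inj₂ _ | inj₂ _ = refl
  ... | inj₁ a | inj₂ b with neg a b
  ...   | true  = refl
  ...   | false = refl
  S≡J-2N i j | inj₂ b | inj₁ a with neg a b
  ...   | true  = refl
  ...   | false = refl

  M≡Q-J : ∀ i j → M i j ≡ Q i j - (𝟙ʳ j * 𝟙ˡ i + 𝟙ˡ j * 𝟙ʳ i)
  M≡Q-J i j = trans (cong (λ s → - (+ 2 * y) * idM i j - s) (S≡J-2N i j))
                    (regroup y (idM i j) (N i j) (𝟙ʳ j * 𝟙ˡ i + 𝟙ˡ j * 𝟙ʳ i))
    where
    regroup : ∀ y δ ν J → - (+ 2 * y) * δ - (J - + 2 * ν) ≡ - + 2 * (y * δ - ν) - J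
    regroup = solve-∀

  a b : ℤ
  a = - (+ 2 * y)
  b = + 2 * + r

  N-𝟙ˡ : ∀ i → (N *ᵥ 𝟙ˡ) i ≡ + r * 𝟙ʳ i
  N-𝟙ˡ = bipartite-*ᵥ-χˡ k _ λ b′ → trans (sumℤ-indicator (λ a′ → neg a′ b′)) (cong +_ (columnDegree b′))

  N-𝟙ʳ : ∀ i → (N *ᵥ 𝟙ʳ) i ≡ + r * 𝟙ˡ i
  N-𝟙ʳ = bipartite-*ᵥ-χʳ k _ λ a′ → trans (sumℤ-indicator (λ b′ → neg a′ b′)) (cong +_ (rowDegree a′))

  Q-*ᵥ : ∀ (w w′ : Fin (k ℕ.+ k) → ℤ) → (∀ i → (N *ᵥ w) i ≡ + r * w′ i) →
         ∀ i → (Q *ᵥ w) i ≡ a * w i + b * w′ i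
  Q-*ᵥ w w′ Nw i = begin
    (Q *ᵥ w) i
      ≡⟨ sumℤ-cong (λ j → cong (w j *_) (expand y (idM i j) (N i j))) ⟩
    ((λ i j → a * idM i j + + 2 * N i j) *ᵥ w) i
      ≡⟨ *ᵥ-linear a (+ 2) idM N w i ⟩
    a * (idM *ᵥ w) i + + 2 * (N *ᵥ w) i
      ≡⟨ cong₂ (λ x z → a * x + + 2 * z) (idM-*ᵥ w i) (Nw i) ⟩
    a * w i + + 2 * (+ r * w′ i)
      ≡⟨ cong (_+_ (a * w i)) (*-assoc (+ 2) (+ r) (w′ i)) ⟨
    a * w i + b * w′ i ∎
    where
    expand : ∀ y δ ν → - + 2 * (y * δ - ν) ≡ - (+ 2 * y) * δ + + 2 * ν
    expand = solve-∀

  𝟙ˡ·𝟙ʳ : sumℤ (λ j → 𝟙ˡ j * 𝟙ʳ j) ≡ 0ℤ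
  𝟙ˡ·𝟙ʳ = trans (sumℤ-splitAt k (λ x → χˡ x * χʳ x))
                (cong₂ _+_ (sumℤ-zero {k} λ _ → refl) (sumℤ-zero {k} λ _ → refl))

  𝟙ʳ·𝟙ˡ : sumℤ (λ j → 𝟙ʳ j * 𝟙ˡ j) ≡ 0ℤ
  𝟙ʳ·𝟙ˡ = trans (sumℤ-splitAt k (λ x → χʳ x * χˡ x))
                (cong₂ _+_ (sumℤ-zero {k} λ _ → refl) (sumℤ-zero {k} λ _ → refl))

  𝟙ˡ·𝟙ˡ : sumℤ (λ j → 𝟙ˡ j * 𝟙ˡ j) ≡ + k
  𝟙ˡ·𝟙ˡ = trans (sumℤ-splitAt k (λ x → χˡ x * χˡ x))
                (trans (cong₂ _+_ (sumℤ-ones k) (sumℤ-zero {k} λ _ → refl)) (+-identityʳ (+ k)))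

  𝟙ʳ·𝟙ʳ : sumℤ (λ j → 𝟙ʳ j * 𝟙ʳ j) ≡ + k
  𝟙ʳ·𝟙ʳ = trans (sumℤ-splitAt k (λ x → χʳ x * χʳ x))
                (cong₂ _+_ (sumℤ-zero {k} λ _ → refl) (sumℤ-ones k))

  M-𝟙ˡ : ∀ i → (M *ᵥ 𝟙ˡ) i ≡ a * 𝟙ˡ i + (b - + k) * 𝟙ʳ i
  M-𝟙ˡ i = begin
    (M *ᵥ 𝟙ˡ) i
      ≡⟨ *ᵥ-rankTwo M Q 𝟙ˡ 𝟙ʳ 𝟙ʳ 𝟙ˡ M≡Q-J 𝟙ˡ i ⟩
    (Q *ᵥ 𝟙ˡ) i - (sumℤ (λ j → 𝟙ˡ j * 𝟙ʳ j) * 𝟙ˡ i + sumℤ (λ j → 𝟙ˡ j * 𝟙ˡ j) * 𝟙ʳ i)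
      ≡⟨ cong₂ (λ q σ → q - (σ * 𝟙ˡ i + sumℤ (λ j → 𝟙ˡ j * 𝟙ˡ j) * 𝟙ʳ i))
               (Q-*ᵥ 𝟙ˡ 𝟙ʳ N-𝟙ˡ i) 𝟙ˡ·𝟙ʳ ⟩
    (a * 𝟙ˡ i + b * 𝟙ʳ i) - (0ℤ * 𝟙ˡ i + sumℤ (λ j → 𝟙ˡ j * 𝟙ˡ j) * 𝟙ʳ i)
      ≡⟨ cong (λ τ → (a * 𝟙ˡ i + b * 𝟙ʳ i) - (0ℤ * 𝟙ˡ i + τ * 𝟙ʳ i)) 𝟙ˡ·𝟙ˡ ⟩
    (a * 𝟙ˡ i + b * 𝟙ʳ i) - (0ℤ * 𝟙ˡ i + + k * 𝟙ʳ i)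
      ≡⟨ simplify a b (+ k) (𝟙ˡ i) (𝟙ʳ i) ⟩
    a * 𝟙ˡ i + (b - + k) * 𝟙ʳ i ∎
    where
    simplify : ∀ a b K u v → (a * u + b * v) - (0ℤ * u + K * v) ≡ a * u + (b - K) * v
    simplify = solve-∀

  M-𝟙ʳ : ∀ i → (M *ᵥ 𝟙ʳ) i ≡ a * 𝟙ʳ i + (b - + k) * 𝟙ˡ i
  M-𝟙ʳ i = begin
    (M *ᵥ 𝟙ʳ) i
      ≡⟨ *ᵥ-rankTwo M Q 𝟙ˡ 𝟙ʳ 𝟙ʳ 𝟙ˡ M≡Q-J 𝟙ʳ i ⟩
    (Q *ᵥ 𝟙ʳ) i - (sumℤ (λ j → 𝟙ʳ j * 𝟙ʳ j) * 𝟙ˡ i + sumℤ (λ j → 𝟙ʳ j * 𝟙ˡ j) * 𝟙ʳ i)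
      ≡⟨ cong₂ (λ q τ → q - (sumℤ (λ j → 𝟙ʳ j * 𝟙ʳ j) * 𝟙ˡ i + τ * 𝟙ʳ i))
               (Q-*ᵥ 𝟙ʳ 𝟙ˡ N-𝟙ʳ i) 𝟙ʳ·𝟙ˡ ⟩
    (a * 𝟙ʳ i + b * 𝟙ˡ i) - (sumℤ (λ j → 𝟙ʳ j * 𝟙ʳ j) * 𝟙ˡ i + 0ℤ * 𝟙ʳ i)
      ≡⟨ cong (λ σ → (a * 𝟙ʳ i + b * 𝟙ˡ i) - (σ * 𝟙ˡ i + 0ℤ * 𝟙ʳ i)) 𝟙ʳ·𝟙ʳ ⟩
    (a * 𝟙ʳ i + b * 𝟙ˡ i) - (+ k * 𝟙ˡ i + 0ℤ * 𝟙ʳ i)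
      ≡⟨ simplify a b (+ k) (𝟙ˡ i) (𝟙ʳ i) ⟩
    a * 𝟙ʳ i + (b - + k) * 𝟙ˡ i ∎
    where
    simplify : ∀ a b K u v → (a * v + b * u) - (K * u + 0ℤ * v) ≡ a * v + (b - K) * u
    simplify = solve-∀

  det-Q : det Q ≡ (+ 4) ^ k * det P
  det-Q = trans (det-scale (- + 2) P) (cong (_* det P) (^-double (- + 2) k))

  module _ (c₀ c₁ : Fin (k ℕ.+ k)) (c₀≢c₁ : c₀ ≢ c₁)
           (𝟙ˡ-c₀ : 𝟙ˡ c₀ ≡ 1ℤ) (𝟙ʳ-c₀ : 𝟙ʳ c₀ ≡ 0ℤ) (𝟙ʳ-c₁ : 𝟙ʳ c₁ ≡ 1ℤ) where

    private
      plane : ∀ β X → (∀ i → (X *ᵥ 𝟙ˡ) i ≡ a * 𝟙ˡ i + β * 𝟙ʳ i) →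
                      (∀ i → (X *ᵥ 𝟙ʳ) i ≡ a * 𝟙ʳ i + β * 𝟙ˡ i) →
                      det X ≡ (a * a - β * β) * det (setColumns c₀ c₁ 𝟙ˡ 𝟙ʳ X)
      plane = det-invariantPlane c₀ c₁ c₀≢c₁ 𝟙ˡ 𝟙ʳ 𝟙ˡ-c₀ 𝟙ʳ-c₀ 𝟙ʳ-c₁ a

    det-Q-plane : det Q ≡ (a * a - b * b) * det (setColumns c₀ c₁ 𝟙ˡ 𝟙ʳ Q)
    det-Q-plane = plane b Q (Q-*ᵥ 𝟙ˡ 𝟙ʳ N-𝟙ˡ) (Q-*ᵥ 𝟙ʳ 𝟙ˡ N-𝟙ʳ)

    det-M-plane : det M ≡ (a * a - (b - + k) * (b - + k)) * det (setColumns c₀ c₁ 𝟙ˡ 𝟙ʳ Q)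
    det-M-plane = trans (plane (b - + k) M M-𝟙ˡ M-𝟙ʳ)
                        (cong ((a * a - (b - + k) * (b - + k)) *_)
                              (det-setColumns-rankTwo c₀ c₁ c₀≢c₁ 𝟙ˡ 𝟙ʳ Q 𝟙ʳ 𝟙ˡ M M≡Q-J))

lemma5p1 : (k r : ℕ) (neg : Fin k → Fin k → Bool) → 1 ≤ k → negRegular k r neg →
           (y : ℤ) →
           charPoly (signedKkkAdj k neg) (- ((+ 2) * y)) * (y * y - (+ r) * (+ r))
             ≡ ((+ 4) * (y * y) - ((+ k) - (+ 2) * (+ r)) * ((+ k) - (+ 2) * (+ r)))
               * ((+ 4) ^ (k ∸ 1) * charPoly (negGraphAdj k neg) y)
lemma5p1 zero     _ _   ()      _                              _
lemma5p1 (suc k′) r neg (s≤s _) (_ , rowDegree , columnDegree) y = begin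
  det M * (y * y - + r * + r)
    ≡⟨ eliminate-common-factor (+ 4) (a * a - (b - + k) * (b - + k)) (y * y - + r * + r)
                               det-M≡ det-Q≡ (trans det-Q (*-assoc (+ 4) ((+ 4) ^ k′) (det P))) ⟩
  (a * a - (b - + k) * (b - + k)) * ((+ 4) ^ k′ * det P)
    ≡⟨ cong (_* ((+ 4) ^ k′ * det P)) (a²-[b-k]² y (+ r) (+ k)) ⟩
  ((+ 4) * (y * y) - (+ k - + 2 * + r) * (+ k - + 2 * + r)) * ((+ 4) ^ k′ * det P) ∎
  where
  k = suc k′
  open SignedCompleteBipartite k r neg rowDegree columnDegree y
  c₁ : Fin (k ℕ.+ k)
  c₁ = k ↑ʳ zero
  𝟙ʳ-c₁ : 𝟙ʳ c₁ ≡ 1ℤ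
  𝟙ʳ-c₁ = cong χʳ (splitAt-↑ʳ k k zero)
  D : ℤ
  D = det (setColumns zero c₁ 𝟙ˡ 𝟙ʳ Q)
  a²-b² : ∀ y ρ → - (+ 2 * y) * - (+ 2 * y) - + 2 * ρ * (+ 2 * ρ) ≡ + 4 * (y * y - ρ * ρ)
  a²-b² = solve-∀
  a²-[b-k]² : ∀ y ρ κ → - (+ 2 * y) * - (+ 2 * y) - (+ 2 * ρ - κ) * (+ 2 * ρ - κ)
                        ≡ (+ 4) * (y * y) - (κ - + 2 * ρ) * (κ - + 2 * ρ)
  a²-[b-k]² = solve-∀
  det-M≡ : det M ≡ (a * a - (b - + k) * (b - + k)) * D
  det-M≡ = det-M-plane zero c₁ (λ ()) refl refl 𝟙ʳ-c₁
  det-Q≡ : det Q ≡ + 4 * (y * y - + r * + r) * D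
  det-Q≡ = trans (det-Q-plane zero c₁ (λ ()) refl refl 𝟙ʳ-c₁) (cong (_* D) (a²-b² y (+ r)))
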